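{- Let $a_1,a_2,\dots$ and $b_1,b_2,\dots$ be complex numbers and $n\ge0$ an integer. Then $$(x-a_1)\cdots(x-a_n)=\sum_{k=0}^{n}\mathrm{comp}_{n-k}(\{a_1,\dots,a_n|b_1,\dots,b_{k+1}\})\,(x-b_1)\cdots(x-b_k).$$
   Context: A hybrid set on a universe $U$ is a function $f:U\to\mathbb{Z}$. $\{a_1,\dots,a_n|b_1,\dots,b_m\}$ denotes the hybrid set $\sum_{i=1}^n\{a_i|\}-\sum_{j=1}^m\{b_j|\}$, where $\{c|\}$ has multiplicity $1$ at $c$ and $0$ elsewhere. For a finitely supported hybrid set $V$ of complex numbers, $\mathrm{comp}_r(V)$ is the coefficient of $t^r$ in $\prod_{c\in\mathbb{C}}(1-ct)^{V(c)}\in\mathbb{C}[[t]]$; for example $\mathrm{comp}_r(\{a_1,\dots,a_n|\})=(-1)^r e_r(a_1,\dots,a_n)$ and $\mathrm{comp}_r(\{|b_1,\dots,b_m\})=h_r(b_1,\dots,b_m)$. -}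

module Defs where

open import Level using (Level)
open import Algebra.Bundles using (CommutativeRing)
open import Data.Nat using (ℕ; zero; suc; _∸_)
open import Data.List using (List; []; _∷_; map; upTo)

module _ {c ℓ : Level} (R : CommutativeRing c ℓ) where
  open CommutativeRing R

  sumTo : ℕ → (ℕ → Carrier) → Carrier
  sumTo zero    f = 0#
  sumTo (suc n) f = sumTo n f + f n

  pow : Carrier → ℕ → Carrier
  pow x zero    = 1#
  pow x (suc n) = pow x n * x

  PowerSeries : Set c
  PowerSeries = ℕ → Carrier

  _⋆_ : PowerSeries → PowerSeries → PowerSeries
  (f ⋆ g) n = sumTo (suc n) (λ i → f i * g (n ∸ i))

  oneS : PowerSeries
  oneS zero    = 1#
  oneS (suc _) = 0#

  linS : Carrier → PowerSeries
  linS x zero          = 1#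
  linS x (suc zero)    = - x
  linS x (suc (suc _)) = 0#

  -- the power series (1 - c t)^(-1) = Σ c^k t^k
  invLinS : Carrier → PowerSeries
  invLinS x k = pow x k

  -- the hybrid set {a_1,...,a_n | b_1,...,b_m} given by the two lists;
  -- its generating series  ∏_i (1 - a_i t) · ∏_j (1 - b_j t)^(-1)
  hybridSeries : List Carrier → List Carrier → PowerSeries
  hybridSeries []       []       = oneS
  hybridSeries []       (b ∷ bs) = invLinS b ⋆ hybridSeries [] bs
  hybridSeries (a ∷ as) bs       = linS a ⋆ hybridSeries as bs

  comp : ℕ → List Carrier → List Carrier → Carrier
  comp r as bs = hybridSeries as bs r

  prodLin : Carrier → List Carrier → Carrier
  prodLin x []       = 1#
  prodLin x (y ∷ ys) = (x - y) * prodLin x ys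

  -- the list [a_1, ..., a_n] of a sequence indexed from 1
  firsts : (ℕ → Carrier) → ℕ → List Carrier
  firsts a n = map (λ i → a (suc i)) (upTo n)

-- Write F k for the generating series of {a_1,…,a_n | b_1,…,b_k}, so that
-- F k = (1 - b_{k+1} t) · F (k + 1) and F 0 = ∏ (1 - a_i t).  Reading the
-- coefficients of F 0 from degree n down as a polynomial in x gives ∏ (x - a_i).
-- Peeling off the factors (1 - b_{k+1} t) one at a time, each step of Horner's
-- scheme splits off the term comp_{n-k}(…) · (x - b_1) ⋯ (x - b_k) and multiplies
-- the remainder by (x - b_{k+1}); after n steps the remainder is the last term.
module Submission where

open import Defs
open import Level using (Level)
open import Algebra.Bundles using (CommutativeRing)
open import Data.Nat using (ℕ; zero; suc; _∸_; _<_; _≤_; s≤s; s≤s⁻¹) renaming (_+_ to _+ℕ_)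
import Data.Nat.Properties as ℕ
open import Data.List using (List; []; _∷_; _∷ʳ_; map; upTo; length)
open import Data.List.Properties using (map-++; length-map; upTo-∷ʳ; length-upTo)
open import Relation.Binary.PropositionalEquality as ≡ using (_≡_)
import Algebra.Properties.Ring as RingProperties
import Algebra.Solver.Ring.NaturalCoefficients.Default as NaturalCoefficientsSolver
import Relation.Binary.Reasoning.Setoid as SetoidReasoning

module _ {c ℓ : Level} (R : CommutativeRing c ℓ) where
  open CommutativeRing R hiding (zero)
  open RingProperties ring using (-‿distribˡ-*)
  open NaturalCoefficientsSolver commutativeSemiring using (solve; _:=_; _:+_; _:*_)
  open SetoidReasoning setoid

  sumTo-cong< : ∀ n {f g : ℕ → Carrier} →
                (∀ i → i < n → f i ≈ g i) → sumTo R n f ≈ sumTo R n g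
  sumTo-cong< zero    f≈g = refl
  sumTo-cong< (suc n) f≈g =
    +-cong (sumTo-cong< n (λ i i<n → f≈g i (ℕ.m<n⇒m<1+n i<n))) (f≈g n (ℕ.n<1+n n))

  sumTo-unconsˡ : ∀ n f → sumTo R (suc n) f ≈ f 0 + sumTo R n (λ i → f (suc i))
  sumTo-unconsˡ zero    f = +-comm 0# (f 0)
  sumTo-unconsˡ (suc n) f = trans (+-congʳ (sumTo-unconsˡ n f)) (+-assoc (f 0) _ _)

  sumTo-distrib-+ : ∀ n f g → sumTo R n (λ i → f i + g i) ≈ sumTo R n f + sumTo R n g
  sumTo-distrib-+ zero    f g = sym (+-identityˡ 0#)
  sumTo-distrib-+ (suc n) f g = trans (+-congʳ (sumTo-distrib-+ n f g))
    (solve 4 (λ sf sg fn gn → (sf :+ sg) :+ (fn :+ gn) := (sf :+ fn) :+ (sg :+ gn)) refl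
       (sumTo R n f) (sumTo R n g) (f n) (g n))

  sumTo-*ˡ : ∀ n b f → sumTo R n (λ i → b * f i) ≈ b * sumTo R n f
  sumTo-*ˡ zero    b f = sym (zeroʳ b)
  sumTo-*ˡ (suc n) b f =
    trans (+-congʳ (sumTo-*ˡ n b f)) (sym (distribˡ b (sumTo R n f) (f n)))

  infix 4 _≋_
  _≋_ : PowerSeries R → PowerSeries R → Set ℓ
  f ≋ g = ∀ r → f r ≈ g r

  ⋆-congˡ : ∀ f {g h} → g ≋ h → _⋆_ R f g ≋ _⋆_ R f h
  ⋆-congˡ f g≋h r = sumTo-cong< (suc r) (λ i _ → *-congˡ (g≋h (r ∸ i)))

  mulLin : Carrier → PowerSeries R → PowerSeries R
  mulLin b f zero    = f zero
  mulLin b f (suc r) = f (suc r) + - b * f r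

  linS-⋆ : ∀ a f → _⋆_ R (linS R a) f ≋ mulLin a f
  linS-⋆ a f zero          = trans (+-identityˡ _) (*-identityˡ _)
  linS-⋆ a f (suc zero)    = +-congʳ (trans (+-identityˡ _) (*-identityˡ _))
  linS-⋆ a f (suc (suc r)) = begin
    sumTo R (suc (suc (suc r))) term
      ≈⟨ sumTo-unconsˡ (suc (suc r)) term ⟩
    term 0 + sumTo R (suc (suc r)) (λ i → term (suc i))
      ≈⟨ +-cong (*-identityˡ _) (sumTo-unconsˡ (suc r) (λ i → term (suc i))) ⟩
    f (suc (suc r)) + (- a * f (suc r) + sumTo R (suc r) (λ i → 0# * f (r ∸ i)))
      ≈⟨ +-congˡ (+-congˡ (trans (sumTo-*ˡ (suc r) 0# (λ i → f (r ∸ i))) (zeroˡ _))) ⟩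
    f (suc (suc r)) + (- a * f (suc r) + 0#)
      ≈⟨ +-congˡ (+-identityʳ _) ⟩
    f (suc (suc r)) + - a * f (suc r)
      ∎
    where
    term : ℕ → Carrier
    term i = linS R a i * f (suc (suc r) ∸ i)

  mulLin-invLinS-⋆ : ∀ b g → mulLin b (_⋆_ R (invLinS R b) g) ≋ g
  mulLin-invLinS-⋆ b g zero    = trans (+-identityˡ _) (*-identityˡ (g 0))
  mulLin-invLinS-⋆ b g (suc r) = begin
    _⋆_ R (invLinS R b) g (suc r) + - b * prev
      ≈⟨ +-congʳ (sumTo-unconsˡ (suc r) (λ i → pow R b i * g (suc r ∸ i))) ⟩
    (1# * g (suc r) + sumTo R (suc r) (λ i → (pow R b i * b) * g (r ∸ i))) + - b * prev
      ≈⟨ +-congʳ (+-cong (*-identityˡ _) (trans (sumTo-cong< (suc r) (λ i _ → shift i))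
                                                (sumTo-*ˡ (suc r) b _))) ⟩
    (g (suc r) + b * prev) + - b * prev      ≈⟨ +-congˡ (sym (-‿distribˡ-* b prev)) ⟩
    (g (suc r) + b * prev) + - (b * prev)    ≈⟨ +-assoc _ _ _ ⟩
    g (suc r) + (b * prev + - (b * prev))    ≈⟨ +-congˡ (-‿inverseʳ _) ⟩
    g (suc r) + 0#                           ≈⟨ +-identityʳ _ ⟩
    g (suc r)                                ∎
    where
    prev : Carrier
    prev = _⋆_ R (invLinS R b) g r
    shift : ∀ i → (pow R b i * b) * g (r ∸ i) ≈ b * (pow R b i * g (r ∸ i))
    shift i = trans (*-congʳ (*-comm _ b)) (*-assoc b _ _)

  ⋆-mulLin : ∀ f b g → _⋆_ R f (mulLin b g) ≋ mulLin b (_⋆_ R f g)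
  ⋆-mulLin f b g zero    = refl
  ⋆-mulLin f b g (suc r) = begin
    sumTo R (suc r) (λ i → f i * mulLin b g (suc r ∸ i)) + f (suc r) * mulLin b g (r ∸ r)
      ≈⟨ +-cong (sumTo-cong< (suc r) (λ i i≤r → expand i (s≤s⁻¹ i≤r))) (*-congˡ (last r)) ⟩
    sumTo R (suc r) (λ i → f i * g (suc r ∸ i) + - b * (f i * g (r ∸ i))) + T
      ≈⟨ +-congʳ (trans (sumTo-distrib-+ (suc r) _ _) (+-congˡ (sumTo-*ˡ (suc r) (- b) _))) ⟩
    (A + - b * B) + T
      ≈⟨ solve 4 (λ A B T nb → (A :+ nb :* B) :+ T := (A :+ T) :+ nb :* B) refl A B T (- b) ⟩
    (A + T) + - b * B
      ∎
    where
    A B T : Carrier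
    A = sumTo R (suc r) (λ i → f i * g (suc r ∸ i))
    B = sumTo R (suc r) (λ i → f i * g (r ∸ i))
    T = f (suc r) * g (r ∸ r)
    unfold : ∀ i → i ≤ r → mulLin b g (suc r ∸ i) ≈ g (suc r ∸ i) + - b * g (r ∸ i)
    unfold i i≤r rewrite ℕ.+-∸-assoc 1 i≤r = refl
    expand : ∀ i → i ≤ r →
             f i * mulLin b g (suc r ∸ i) ≈ f i * g (suc r ∸ i) + - b * (f i * g (r ∸ i))
    expand i i≤r = trans (*-congˡ (unfold i i≤r))
      (solve 4 (λ fi g₁ g₀ nb → fi :* (g₁ :+ nb :* g₀) := fi :* g₁ :+ nb :* (fi :* g₀)) refl
         (f i) (g (suc r ∸ i)) (g (r ∸ i)) (- b))
    last : ∀ r → mulLin b g (r ∸ r) ≈ g (r ∸ r)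
    last r rewrite ℕ.n∸n≡0 r = refl

  mulLin-hybridSeries-∷ʳ : ∀ as bs b →
                           mulLin b (hybridSeries R as (bs ∷ʳ b)) ≋ hybridSeries R as bs
  mulLin-hybridSeries-∷ʳ []       []        b   = mulLin-invLinS-⋆ b (oneS R)
  mulLin-hybridSeries-∷ʳ []       (b′ ∷ bs) b r =
    trans (sym (⋆-mulLin (invLinS R b′) b _ r))
          (⋆-congˡ (invLinS R b′) (mulLin-hybridSeries-∷ʳ [] bs b) r)
  mulLin-hybridSeries-∷ʳ (a ∷ as) bs        b r =
    trans (sym (⋆-mulLin (linS R a) b _ r))
          (⋆-congˡ (linS R a) (mulLin-hybridSeries-∷ʳ as bs b) r)

  hybridSeries-[]-vanishes : ∀ as r → length as < r → hybridSeries R as [] r ≈ 0#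
  hybridSeries-[]-vanishes []       (suc r)       _         = refl
  hybridSeries-[]-vanishes (a ∷ as) (suc (suc r)) (s≤s l<r) = begin
    hybridSeries R (a ∷ as) [] (suc (suc r))
      ≈⟨ linS-⋆ a (hybridSeries R as []) (suc (suc r)) ⟩
    hybridSeries R as [] (suc (suc r)) + - a * hybridSeries R as [] (suc r)
      ≈⟨ +-cong (hybridSeries-[]-vanishes as (suc (suc r)) (ℕ.m<n⇒m<1+n l<r))
                (*-congˡ (hybridSeries-[]-vanishes as (suc r) l<r)) ⟩
    0# + - a * 0#
      ≈⟨ trans (+-identityˡ _) (zeroʳ _) ⟩
    0#
      ∎

  firsts-suc : ∀ b k → firsts R b (suc k) ≡ firsts R b k ∷ʳ b (suc k)
  firsts-suc b k = ≡.trans (≡.cong (map (λ i → b (suc i))) (≡.sym (upTo-∷ʳ k)))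
                           (map-++ (λ i → b (suc i)) (upTo k) (k ∷ []))

  length-firsts : ∀ a n → length (firsts R a n) ≡ n
  length-firsts a n = ≡.trans (length-map _ (upTo n)) (length-upTo n)

  module _ (x : Carrier) where

    prodLin-∷ʳ : ∀ ys y → prodLin R x (ys ∷ʳ y) ≈ prodLin R x ys * (x - y)
    prodLin-∷ʳ []       y = *-comm (x - y) 1#
    prodLin-∷ʳ (z ∷ ys) y = trans (*-congˡ (prodLin-∷ʳ ys y)) (sym (*-assoc _ _ _))

    -- horner f m = Σ_{i ≤ m} f i · x ^ (m ∸ i): the coefficient f i sits in degree m ∸ i.
    horner : PowerSeries R → ℕ → Carrier
    horner f zero    = f 0
    horner f (suc m) = horner f m * x + f (suc m)

    horner-mulLin : ∀ β {f g} → f ≋ mulLin β g →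
                    ∀ m → horner f (suc m) ≈ g (suc m) + (x - β) * horner g m
    horner-mulLin β {f} {g} f≋ zero    = trans (+-cong (*-congʳ (f≋ 0)) (f≋ 1))
      (solve 4 (λ x nβ g₀ g₁ → g₀ :* x :+ (g₁ :+ nβ :* g₀) := g₁ :+ (x :+ nβ) :* g₀) refl
         x (- β) (g 0) (g 1))
    horner-mulLin β {f} {g} f≋ (suc m) =
      trans (+-cong (*-congʳ (horner-mulLin β f≋ m)) (f≋ (suc (suc m))))
        (solve 5 (λ x nβ g₁ h g₂ → (g₁ :+ (x :+ nβ) :* h) :* x :+ (g₂ :+ nβ :* g₁)
                                   := g₂ :+ (x :+ nβ) :* (h :* x :+ g₁)) refl
           x (- β) (g (suc m)) (horner g m) (g (suc (suc m))))

    horner-hybridSeries-[] : ∀ as → horner (hybridSeries R as []) (length as) ≈ prodLin R x as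
    horner-hybridSeries-[] []       = refl
    horner-hybridSeries-[] (a ∷ as) = begin
      horner (hybridSeries R (a ∷ as) []) (suc (length as))
        ≈⟨ horner-mulLin a (linS-⋆ a (hybridSeries R as [])) (length as) ⟩
      hybridSeries R as [] (suc (length as)) + (x - a) * horner (hybridSeries R as []) (length as)
        ≈⟨ +-cong (hybridSeries-[]-vanishes as _ ℕ.≤-refl) (*-congˡ (horner-hybridSeries-[] as)) ⟩
      0# + (x - a) * prodLin R x as
        ≈⟨ +-identityˡ _ ⟩
      prodLin R x (a ∷ as)
        ∎

    horner-expansion : (F : ℕ → PowerSeries R) (b : ℕ → Carrier) →
      (∀ k → F k ≋ mulLin (b (suc k)) (F (suc k))) →
      ∀ n → horner (F 0) n ≈ sumTo R (suc n) (λ k → F (suc k) (n ∸ k) * prodLin R x (firsts R b k))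
    horner-expansion F b F-step n = begin
      horner (F 0) n                         ≈⟨ invariant n 0 (ℕ.+-identityʳ n) ⟩
      sumTo R n term + horner (F n) 0 * π n  ≈⟨ +-congˡ (*-congʳ last) ⟩
      sumTo R (suc n) term                   ∎
      where
      π : ℕ → Carrier
      π k = prodLin R x (firsts R b k)
      term : ℕ → Carrier
      term k = F (suc k) (n ∸ k) * π k
      π-suc : ∀ k → π (suc k) ≈ π k * (x - b (suc k))
      π-suc k = trans (reflexive (≡.cong (prodLin R x) (firsts-suc b k)))
                      (prodLin-∷ʳ (firsts R b k) (b (suc k)))
      last : F n 0 ≈ F (suc n) (n ∸ n)
      last = trans (F-step n 0) (reflexive (≡.cong (F (suc n)) (≡.sym (ℕ.n∸n≡0 n))))
      invariant : ∀ k m → k +ℕ m ≡ n → horner (F 0) n ≈ sumTo R k term + horner (F k) m * π k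
      invariant zero    m ≡.refl = sym (trans (+-identityˡ _) (*-identityʳ _))
      invariant (suc k) m k+m≡n = begin
        horner (F 0) n
          ≈⟨ invariant k (suc m) (≡.trans (ℕ.+-suc k m) k+m≡n) ⟩
        sumTo R k term + horner (F k) (suc m) * π k
          ≈⟨ +-congˡ (*-congʳ (horner-mulLin (b (suc k)) (F-step k) m)) ⟩
        sumTo R k term + (F (suc k) (suc m) + (x - b (suc k)) * horner (F (suc k)) m) * π k
          ≈⟨ solve 5 (λ s f y h p → s :+ (f :+ y :* h) :* p := (s :+ f :* p) :+ h :* (p :* y))
               refl (sumTo R k term) (F (suc k) (suc m)) (x - b (suc k)) (horner (F (suc k)) m) (π k) ⟩
        (sumTo R k term + F (suc k) (suc m) * π k) + horner (F (suc k)) m * (π k * (x - b (suc k)))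
          ≈⟨ +-cong (+-congˡ (*-congʳ (reflexive (≡.cong (F (suc k)) (≡.sym n∸k≡1+m)))))
                    (*-congˡ (sym (π-suc k))) ⟩
        sumTo R (suc k) term + horner (F (suc k)) m * π (suc k)
          ∎
        where
        n∸k≡1+m : n ∸ k ≡ suc m
        n∸k≡1+m = ≡.trans (≡.cong (_∸ k) (≡.sym (≡.trans (ℕ.+-suc k m) k+m≡n)))
                          (ℕ.m+n∸m≡n k (suc m))

mainTheorem6 : {c ℓ : Level} (R : CommutativeRing c ℓ) →
    let open CommutativeRing R in
    (a b : ℕ → Carrier) (n : ℕ) (x : Carrier) →
    prodLin R x (firsts R a n)
    ≈ sumTo R (suc n)
    (λ k → comp R (n ∸ k) (firsts R a n) (firsts R b (suc k))
    * prodLin R x (firsts R b k))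
mainTheorem6 R a b n x = begin
  prodLin R x as                ≈⟨ horner-hybridSeries-[] R x as ⟨
  horner R x (F 0) (length as)  ≡⟨ ≡.cong (horner R x (F 0)) (length-firsts R a n) ⟩
  horner R x (F 0) n            ≈⟨ horner-expansion R x F b F-step n ⟩
  sumTo R (suc n) (λ k → F (suc k) (n ∸ k) * prodLin R x (firsts R b k)) ∎
  where
  open CommutativeRing R
  open SetoidReasoning setoid
  as : List Carrier
  as = firsts R a n
  F : ℕ → PowerSeries R
  F k = hybridSeries R as (firsts R b k)
  F-step : ∀ k → _≋_ R (F k) (mulLin R (b (suc k)) (F (suc k)))
  F-step k r rewrite firsts-suc R b k =
    sym (mulLin-hybridSeries-∷ʳ R as (firsts R b k) (b (suc k)) r)
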